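{- Let $n\ge3$, let $G$ be a spanning subgraph of $CT_n$, and let $l\ge 3$ be an integer. If there exists an $l$-cycle in $G_x^i$ for some $i\in\{0,1,\dots,n\}$ and some $x\in\mathrm{S}_n$, then there exists a $2l$-cycle in $G$.
   Context: $\mathrm{S}_n$ is the symmetric group on $\{1,\dots,n\}$; $CT_n$ is the graph with vertex set $\mathrm{S}_n$ in which $x,y$ are adjacent iff $y=ux$ for some transposition $u$. For $x\in\mathrm{S}_n$, $\mathrm{supp}(x)=\{i:i^x\ne i\}$, and for an edge $\{u,z\}$ of $CT_n$, $\mathrm{supp}(\{u,z\})=\mathrm{supp}(zu^{ -1})$. Let $\mathscr F_0$ be the set of all transpositions of $\mathrm{S}_n$ and, for $i\in\{1,\dots,n\}$, $\mathscr F_i=\{y\in\mathscr F_0: i\in\mathrm{supp}(y)\}$. For a spanning subgraph $G$ of $CT_n$, $i\in\{0,1,\dots,n\}$ and $x\in\mathrm{S}_n$, the auxiliary graph $G_x^i$ has vertex set $\{yx: y\in\mathscr F_i\}$, and two of its vertices $u,z$ are adjacent iff $|\mathrm{supp}(\{x,u\})\cap\mathrm{supp}(\{x,z\})|=\delta_i$ and there is a vertex $w\ne x$ such that $(u,w,z)$ is a $2$-path in $G$; here $\delta_0=0$ and $\delta_i=1$ for $i\in\{1,\dots,n\}$. -}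

module Defs where

open import Data.Nat using (ℕ; _≥_)
open import Data.Fin using (Fin; zero; suc; toℕ)
open import Data.Nat.DivMod using (_mod_)
open import Data.Empty using (⊥)
open import Data.Unit using (⊤)
open import Data.Fin.Properties using (_≟_)
open import Data.Fin.Permutation using (Permutation′; _⟨$⟩ʳ_; _≈_; flip; _∘ₚ_; transpose)
open import Data.List using (length; filter)
open import Data.List.Base using (allFin)
open import Data.Product using (Σ; ∃; ∃-syntax; _×_; _,_)
open import Relation.Binary.PropositionalEquality using (_≡_; _≢_)
open import Relation.Nullary using (¬_; _×-dec_; ¬?)

-- Product convention: x ∘ₚ y means "first x, then y", i.e. i^(xy) = (i^x)^y,
-- matching the paper's right-action notation; we write x · y for it.
Sym : ℕ → Set
Sym n = Permutation′ n

infixl 7 _·_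
_·_ : ∀ {n} → Sym n → Sym n → Sym n
x · y = x ∘ₚ y

_⁻¹ : ∀ {n} → Sym n → Sym n
x ⁻¹ = flip x

_∈supp_ : ∀ {n} → Fin n → Sym n → Set
k ∈supp x = x ⟨$⟩ʳ k ≢ k

|supp∩supp| : ∀ {n} → Sym n → Sym n → ℕ
|supp∩supp| a b =
  length (filter (λ k → ¬? ((a ⟨$⟩ʳ k) ≟ k) ×-dec ¬? ((b ⟨$⟩ʳ k) ≟ k)) (allFin _))

IsTransposition : ∀ {n} → Sym n → Set
IsTransposition {n} t = Σ (Fin n) λ a → Σ (Fin n) λ b → a ≢ b × t ≈ transpose a b

CTAdj : ∀ {n} → Sym n → Sym n → Set
CTAdj x y = ∃[ u ] (IsTransposition u × y ≈ u · x)

record SpanningSubgraph (n : ℕ) : Set₁ where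
  field
    Edge      : Sym n → Sym n → Set
    sym       : ∀ {x y} → Edge x y → Edge y x
    respects  : ∀ {x x′ y y′} → x ≈ x′ → y ≈ y′ → Edge x y → Edge x′ y′
    subgraph  : ∀ {x y} → Edge x y → CTAdj x y

-- The index i ∈ {0,1,…,n} is encoded as Fin (ℕ.suc n): zero ↦ 0, suc k ↦ k+1
-- (points of {1,…,n} are encoded as Fin n, 0-based).
-- y ∈ 𝓕_i
InF : ∀ {n} → Fin (ℕ.suc n) → Sym n → Set
InF zero    y = IsTransposition y
InF (suc k) y = IsTransposition y × k ∈supp y

δ : ∀ {n} → Fin (ℕ.suc n) → ℕ
δ zero    = 0
δ (suc _) = 1

AuxVertex : ∀ {n} → Fin (ℕ.suc n) → Sym n → Sym n → Set
AuxVertex i x v = ∃[ y ] (InF i y × v ≈ y · x)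

-- supp of the edge {u,z} is supp(z u⁻¹); supp({x,u}) = supp(u x⁻¹)
-- Adjacency in G_x^i (for vertices u, z of G_x^i)
AuxAdj : ∀ {n} → SpanningSubgraph n → Fin (ℕ.suc n) → Sym n → Sym n → Sym n → Set
AuxAdj G i x u z =
  |supp∩supp| (u · x ⁻¹) (z · x ⁻¹) ≡ δ i
  × ∃[ w ] (¬ (w ≈ x) × Edge u w × Edge w z)
  where open SpanningSubgraph G

next : ∀ {m} → Fin (ℕ.suc m) → Fin (ℕ.suc m)
next {m} k = (ℕ.suc (toℕ k)) mod (ℕ.suc m)

Cycle : ∀ {n} → (V : Sym n → Set) → (A : Sym n → Sym n → Set) → ℕ → Set
Cycle V A ℕ.zero = ⊥
Cycle {n} V A (ℕ.suc m) =
  Σ (Fin (ℕ.suc m) → Sym n) λ v →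
    (∀ j → V (v j))
    × (∀ j k → j ≢ k → ¬ (v j ≈ v k))
    × (∀ j → A (v j) (v (next j)))

CycleIn : ∀ {n} → SpanningSubgraph n → ℕ → Set
CycleIn {n} G l = Cycle (λ _ → ⊤) (SpanningSubgraph.Edge G) l

CycleInAux : ∀ {n} → SpanningSubgraph n → Fin (ℕ.suc n) → Sym n → ℕ → Set
CycleInAux G i x l = Cycle (AuxVertex i x) (AuxAdj G i x) l

{-# OPTIONS --safe #-}
-- Let vⱼ = yⱼ x be the l-cycle of G_x^i and wⱼ ≠ x the middle vertex of a 2-path vⱼ wⱼ vⱼ₊₁
-- in G; the closed walk v₀ w₀ v₁ w₁ … v_{l-1} w_{l-1} is the 2l-cycle once its vertices are
-- distinct. Put σ = w x⁻¹ for a middle vertex w. Every vertex y x of G_x^i adjacent to w in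
-- CT_n gives σ = t y with t a transposition, so σ is even and no wⱼ is a vₖ. Moreover w has at
-- most two such neighbours: for i = 0 two of them are disjoint transpositions p, q, so the
-- non-identity σ is p q, whose only transposition factors are p and q; for i ≥ 1 a non-identity
-- σ cannot have three distinct factors (i a), (i b), (i c). As wⱼ is adjacent to vⱼ and vⱼ₊₁
-- and l ≥ 3, this makes the wⱼ pairwise distinct.
module Submission where

open import Defs
open import Data.Bool using (Bool; true; false)
open import Data.Empty using (⊥)
open import Data.Fin using (Fin; zero; suc; toℕ)
open import Data.Fin.Permutation using (_⟨$⟩ʳ_; _⟨$⟩ˡ_; _≈_; inverseˡ; inverseʳ)
open import Data.Fin.Permutation.Components using (transpose; transpose-inverse)
open import Data.Fin.Properties using (_≟_; toℕ-fromℕ<; toℕ-injective; toℕ<n; toℕ≤pred[n])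
open import Data.List.Membership.Propositional.Properties using (∈-filter⁺; ∈-allFin; ∈-length)
open import Data.Nat using (ℕ; zero; suc; _+_; _*_; _<_; _≤_; _≥_; _%_; s≤s)
open import Data.Nat.DivMod using (_mod_; m<n⇒m%n≡m; n%n≡0; %-distribˡ-+; m%n%n≡m%n)
open import Data.Nat.Properties
  using (0≢1+n; 1+n≢n; m≢1+n+m; suc-injective; <⇒≢; ≤-refl; n≤1+n; ≤-<-trans; m≤n⇒m<n∨m≡n;
         *-suc; *-cancelˡ-<)
open import Data.Product using (Σ; ∃-syntax; _×_; _,_; proj₁)
open import Data.Sum using (_⊎_; inj₁; inj₂)
open import Data.Unit using (tt)
open import Function using (_∘_; id)
open import Relation.Nullary using (¬_; Dec; yes; no; ¬?; _×-dec_; contradiction)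
open import Relation.Binary.PropositionalEquality
open ≡-Reasoning

module _ {n : ℕ} where

  IsSwap : (Fin n → Fin n) → Set
  IsSwap f = Σ (Fin n) λ a → Σ (Fin n) λ b → a ≢ b × f ≗ transpose a b

  SwapAdjacent : (Fin n → Fin n) → (Fin n → Fin n) → Set
  SwapAdjacent y σ = Σ (Fin n → Fin n) λ t → IsSwap t × σ ≗ y ∘ t

  Disjoint : (Fin n → Fin n) → (Fin n → Fin n) → Set
  Disjoint p q = ∀ k → p k ≢ k → q k ≡ k

  transpose-ˡ : (a b : Fin n) → transpose a b a ≡ b
  transpose-ˡ a b with a ≟ a
  ... | yes _ = refl
  ... | no a≢a = contradiction refl a≢a

  transpose-ʳ : (a b : Fin n) → transpose a b b ≡ a
  transpose-ʳ a b with b ≟ a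
  ... | yes b≡a = b≡a
  ... | no _ with b ≟ b
  ...   | yes _ = refl
  ...   | no b≢b = contradiction refl b≢b

  transpose-fix : ∀ {a b k : Fin n} → k ≢ a → k ≢ b → transpose a b k ≡ k
  transpose-fix {a} {b} {k} k≢a k≢b with k ≟ a
  ... | yes k≡a = contradiction k≡a k≢a
  ... | no _ with k ≟ b
  ...   | yes k≡b = contradiction k≡b k≢b
  ...   | no _ = refl

  transpose-comm : (a b : Fin n) → transpose a b ≗ transpose b a
  transpose-comm a b k = from (k ≟ a) (k ≟ b)
    where
    from : Dec (k ≡ a) → Dec (k ≡ b) → transpose a b k ≡ transpose b a k
    from (yes refl) _ = trans (transpose-ˡ k b) (sym (transpose-ʳ b k))
    from (no _) (yes refl) = trans (transpose-ʳ a k) (sym (transpose-ˡ k a))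
    from (no k≢a) (no k≢b) = trans (transpose-fix k≢a k≢b) (sym (transpose-fix k≢b k≢a))

  transpose-involutive : (a b : Fin n) → ∀ k → transpose a b (transpose a b k) ≡ k
  transpose-involutive a b k = trans (cong (transpose a b) (transpose-comm a b k)) (transpose-inverse a b)

  swap-involutive : ∀ {f} → IsSwap f → ∀ k → f (f k) ≡ k
  swap-involutive {f} (a , b , _ , f≗ab) k = begin
    f (f k)                         ≡⟨ f≗ab (f k) ⟩
    transpose a b (f k)             ≡⟨ cong (transpose a b) (f≗ab k) ⟩
    transpose a b (transpose a b k) ≡⟨ transpose-involutive a b k ⟩
    k                               ∎

  swap-≢-id : ∀ {f} → IsSwap f → ¬ f ≗ id
  swap-≢-id (a , b , a≢b , f≗ab) f≗id = a≢b (trans (sym (f≗id a)) (trans (f≗ab a) (transpose-ˡ a b)))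

  swap-determined : ∀ {f a b} → IsSwap f → f a ≡ b → a ≢ b → f ≗ transpose a b
  swap-determined {f} {a} {b} (c , d , c≢d , f≗cd) fa≡b a≢b = from (a ≟ c) (a ≟ d)
    where
    fa≡ : f a ≡ transpose c d a
    fa≡ = f≗cd a
    from : Dec (a ≡ c) → Dec (a ≡ d) → f ≗ transpose a b
    from (yes refl) _ k = trans (f≗cd k) (cong (λ e → transpose a e k) d≡b)
      where
      d≡b : d ≡ b
      d≡b = trans (sym (transpose-ˡ a d)) (trans (sym fa≡) fa≡b)
    from (no _) (yes refl) k = trans (f≗cd k) (trans (transpose-comm c a k) (cong (λ e → transpose a e k) c≡b))
      where
      c≡b : c ≡ b
      c≡b = trans (sym (transpose-ʳ c a)) (trans (sym fa≡) fa≡b)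
    from (no a≢c) (no a≢d) = contradiction (trans (sym (transpose-fix a≢c a≢d)) (trans (sym fa≡) fa≡b)) a≢b

  swap-on-moved : ∀ {f a b} → IsSwap f → f a ≢ a → f b ≢ b → a ≢ b → f ≗ transpose a b
  swap-on-moved {f} {a} {b} f-swap fa≢a fb≢b a≢b with b ≟ f a
  ... | yes refl = swap-determined f-swap refl a≢b
  ... | no b≢fa = contradiction
    (trans (swap-determined f-swap refl (≢-sym fa≢a) b) (transpose-fix (≢-sym a≢b) b≢fa)) fb≢b

  moved-swap-determined : ∀ {p q i} → IsSwap p → IsSwap q → p i ≢ i → p i ≡ q i → p ≗ q
  moved-swap-determined {p} {q} {i} p-swap q-swap pi≢i pi≡qi k =
    trans (swap-determined p-swap pi≡qi i≢qi k) (sym (swap-determined q-swap refl i≢qi k))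
    where
    i≢qi : i ≢ q i
    i≢qi i≡qi = pi≢i (trans pi≡qi (sym i≡qi))

  swap-not-swapAdjacent : ∀ {p r} → IsSwap p → IsSwap r → ¬ SwapAdjacent p r
  swap-not-swapAdjacent {p} {r} p-swap r-swap (t , t-swap@(c , d , c≢d , t≗cd) , r≗pt) =
    from (p d ≟ c) (p c ≟ d)
    where
    tc≡d : t c ≡ d
    tc≡d = trans (t≗cd c) (transpose-ˡ c d)
    td≡c : t d ≡ c
    td≡c = trans (t≗cd d) (transpose-ʳ c d)
    p≗t⇒⊥ : p ≗ t → ⊥
    p≗t⇒⊥ p≗t = swap-≢-id r-swap λ k → trans (r≗pt k) (trans (p≗t (t k)) (swap-involutive t-swap k))
    r≗t⇒⊥ : r ≗ t → ⊥
    r≗t⇒⊥ r≗t = swap-≢-id p-swap λ k → begin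
      p k           ≡⟨ cong p (swap-involutive t-swap k) ⟨
      p (t (t k))   ≡⟨ r≗pt (t k) ⟨
      r (t k)       ≡⟨ r≗t (t k) ⟩
      t (t k)       ≡⟨ swap-involutive t-swap k ⟩
      k             ∎
    from : Dec (p d ≡ c) → Dec (p c ≡ d) → ⊥
    from (yes pd≡c) _ = p≗t⇒⊥ λ k →
      trans (swap-determined p-swap pd≡c (≢-sym c≢d) k) (trans (transpose-comm d c k) (sym (t≗cd k)))
    from (no _) (yes pc≡d) = p≗t⇒⊥ λ k → trans (swap-determined p-swap pc≡d c≢d k) (sym (t≗cd k))
    from (no pd≢c) (no pc≢d) = r≗t⇒⊥ λ k → trans (swap-on-moved r-swap rc≢c rd≢d c≢d k) (sym (t≗cd k))
      where
      rc≢c : r c ≢ c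
      rc≢c rc≡c = pd≢c (trans (sym (trans (r≗pt c) (cong p tc≡d))) rc≡c)
      rd≢d : r d ≢ d
      rd≢d rd≡d = pc≢d (trans (sym (trans (r≗pt d) (cong p td≡c))) rd≡d)

  disjoint-sym : ∀ {p q} → Disjoint p q → Disjoint q p
  disjoint-sym {p} {q} p⊥q k qk≢k with p k ≟ k
  ... | yes pk≡k = pk≡k
  ... | no pk≢k = contradiction (p⊥q k pk≢k) qk≢k

  swapFactors-of-disjoint : ∀ {t u p q} → IsSwap t → IsSwap u → IsSwap p → IsSwap q → Disjoint p q →
    t ∘ u ≗ p ∘ q → t ≗ p ⊎ t ≗ q
  swapFactors-of-disjoint {t} {u} {p} {q} t-swap u-swap (a , b , a≢b , p≗ab) (c , d , c≢d , q≗cd) p⊥q tu≗pq =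
    from (u a ≟ a) (u a ≟ b)
    where
    pa≡b : p a ≡ b
    pa≡b = trans (p≗ab a) (transpose-ˡ a b)
    pb≡a : p b ≡ a
    pb≡a = trans (p≗ab b) (transpose-ʳ a b)
    qc≡d : q c ≡ d
    qc≡d = trans (q≗cd c) (transpose-ˡ c d)
    qa≡a : q a ≡ a
    qa≡a = p⊥q a λ pa≡a → a≢b (trans (sym pa≡a) pa≡b)
    qb≡b : q b ≡ b
    qb≡b = p⊥q b λ pb≡b → a≢b (trans (sym pb≡a) pb≡b)
    pd≡d : p d ≡ d
    pd≡d = disjoint-sym p⊥q d λ qd≡d → c≢d (trans (sym (trans (q≗cd d) (transpose-ʳ c d))) qd≡d)
    from : Dec (u a ≡ a) → Dec (u a ≡ b) → t ≗ p ⊎ t ≗ q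
    from (yes ua≡a) _ = inj₁ λ k → trans (swap-determined t-swap ta≡b a≢b k) (sym (p≗ab k))
      where
      ta≡b : t a ≡ b
      ta≡b = trans (cong t (sym ua≡a)) (trans (tu≗pq a) (trans (cong p qa≡a) pa≡b))
    from (no _) (yes ua≡b) = inj₂ λ k → trans (swap-determined t-swap tc≡d c≢d k) (sym (q≗cd k))
      where
      q-fixes≢c : ∀ {e} → q e ≡ e → c ≢ e
      q-fixes≢c qe≡e c≡e = c≢d (trans (sym (trans (cong q c≡e) (trans qe≡e (sym c≡e)))) qc≡d)
      uc≡c : u c ≡ c
      uc≡c = trans (swap-determined u-swap ua≡b a≢b c) (transpose-fix (q-fixes≢c qa≡a) (q-fixes≢c qb≡b))
      tc≡d : t c ≡ d
      tc≡d = trans (cong t (sym uc≡c)) (trans (tu≗pq c) (trans (cong p qc≡d) pd≡d))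
    from (no ua≢a) (no ua≢b) = contradiction (trans (sym tb≡ua) tb≡a) ua≢a
      where
      ub≡b : u b ≡ b
      ub≡b = trans (swap-determined u-swap refl (≢-sym ua≢a) b) (transpose-fix (≢-sym a≢b) (≢-sym ua≢b))
      tb≡ua : t b ≡ u a
      tb≡ua = trans (swap-determined t-swap (trans (tu≗pq a) (trans (cong p qa≡a) pa≡b)) ua≢b b)
                    (transpose-ʳ (u a) b)
      tb≡a : t b ≡ a
      tb≡a = trans (cong t (sym ub≡b)) (trans (tu≗pq b) (trans (cong p qb≡b) pb≡a))

  swapNeighbours-of-disjoint : ∀ {p q r σ} → IsSwap p → IsSwap q → IsSwap r → Disjoint p q → ¬ σ ≗ id →
    SwapAdjacent p σ → SwapAdjacent q σ → SwapAdjacent r σ → r ≗ p ⊎ r ≗ q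
  swapNeighbours-of-disjoint {p} {q} {r} {σ} p-swap q-swap r-swap p⊥q σ≢id
    (t₁ , t₁-swap , σ≗pt₁) (t₂ , t₂-swap , σ≗qt₂) (t₃ , t₃-swap , σ≗rt₃)
    with swapFactors-of-disjoint t₁-swap t₂-swap p-swap q-swap p⊥q t₁t₂≗pq
    where
    t₁t₂≗pq : t₁ ∘ t₂ ≗ p ∘ q
    t₁t₂≗pq k = begin
      t₁ (t₂ k)          ≡⟨ swap-involutive p-swap _ ⟨
      p (p (t₁ (t₂ k)))  ≡⟨ cong p (σ≗pt₁ (t₂ k)) ⟨
      p (σ (t₂ k))       ≡⟨ cong p (σ≗qt₂ (t₂ k)) ⟩
      p (q (t₂ (t₂ k)))  ≡⟨ cong (p ∘ q) (swap-involutive t₂-swap k) ⟩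
      p (q k)            ∎
  ... | inj₁ t₁≗p =
    contradiction (λ k → trans (σ≗pt₁ k) (trans (cong p (t₁≗p k)) (swap-involutive p-swap k))) σ≢id
  ... | inj₂ t₁≗q = swapFactors-of-disjoint r-swap t₃-swap p-swap q-swap p⊥q
                      λ k → trans (sym (σ≗rt₃ k)) (trans (σ≗pt₁ k) (cong p (t₁≗q k)))

  -- With a = p i and b = q i: from σ = (i a) t₁ = (i b) t₂ and σ m = i one gets t₁ = (m a),
  -- t₂ = (m b), hence σ a = a, i.e. p m = a, so m = i and t₁ = p.
  moved-swapNeighbours-pair : ∀ {i m p q σ} → IsSwap p → IsSwap q → p i ≢ i → q i ≢ i → p i ≢ q i →
    SwapAdjacent p σ → SwapAdjacent q σ → σ m ≡ i → m ≢ p i → m ≢ q i → σ ≗ id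
  moved-swapNeighbours-pair {i} {m} {p} {q} {σ} p-swap q-swap pi≢i qi≢i pi≢qi
    (t₁ , t₁-swap , σ≗pt₁) (t₂ , t₂-swap , σ≗qt₂) σm≡i m≢pi m≢qi k =
    trans (σ≗pt₁ k) (trans (cong p (t₁≗p k)) (swap-involutive p-swap k))
    where
    t₁m≡pi : t₁ m ≡ p i
    t₁m≡pi = trans (sym (swap-involutive p-swap (t₁ m))) (cong p (trans (sym (σ≗pt₁ m)) σm≡i))
    t₂m≡qi : t₂ m ≡ q i
    t₂m≡qi = trans (sym (swap-involutive q-swap (t₂ m))) (cong q (trans (sym (σ≗qt₂ m)) σm≡i))
    σpi≡pi : σ (p i) ≡ p i
    σpi≡pi = begin
      σ (p i)      ≡⟨ σ≗qt₂ (p i) ⟩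
      q (t₂ (p i)) ≡⟨ cong q (trans (swap-determined t₂-swap t₂m≡qi m≢qi (p i))
                                    (transpose-fix (≢-sym m≢pi) pi≢qi)) ⟩
      q (p i)      ≡⟨ trans (swap-determined q-swap refl (≢-sym qi≢i) (p i)) (transpose-fix pi≢i pi≢qi) ⟩
      p i          ∎
    m≡i : m ≡ i
    m≡i = begin
      m                 ≡⟨ swap-involutive p-swap m ⟨
      p (p m)           ≡⟨ cong (p ∘ p) (trans (sym (transpose-ʳ m (p i)))
                                              (sym (swap-determined t₁-swap t₁m≡pi m≢pi (p i)))) ⟩
      p (p (t₁ (p i)))  ≡⟨ cong p (trans (sym (σ≗pt₁ (p i))) σpi≡pi) ⟩
      p (p i)           ≡⟨ swap-involutive p-swap i ⟩
      i                 ∎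
    t₁i≡pi : t₁ i ≡ p i
    t₁i≡pi = trans (cong t₁ (sym m≡i)) t₁m≡pi
    t₁≗p : t₁ ≗ p
    t₁≗p = moved-swap-determined t₁-swap p-swap (λ t₁i≡i → pi≢i (trans (sym t₁i≡pi) t₁i≡i)) t₁i≡pi

  moved-swapNeighbours : ∀ {i p q r σ} → IsSwap p → IsSwap q → IsSwap r → p i ≢ i → q i ≢ i → r i ≢ i →
    p i ≢ q i → r i ≢ p i → r i ≢ q i →
    SwapAdjacent p σ → SwapAdjacent q σ → SwapAdjacent r σ → σ ≗ id
  moved-swapNeighbours {i} {p} {q} {r} {σ} p-swap q-swap r-swap pi≢i qi≢i ri≢i pi≢qi ri≢pi ri≢qi
    σp@(t₁ , t₁-swap , σ≗pt₁) σq σr = from (m ≟ p i) (m ≟ q i)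
    where
    m : Fin n
    m = t₁ (p i)
    σm≡i : σ m ≡ i
    σm≡i = trans (σ≗pt₁ m) (trans (cong p (swap-involutive t₁-swap (p i))) (swap-involutive p-swap i))
    from : Dec (m ≡ p i) → Dec (m ≡ q i) → σ ≗ id
    from (yes m≡pi) _ = moved-swapNeighbours-pair q-swap r-swap qi≢i ri≢i (≢-sym ri≢qi) σq σr σm≡i
      (λ m≡qi → pi≢qi (trans (sym m≡pi) m≡qi)) (λ m≡ri → ri≢pi (trans (sym m≡ri) m≡pi))
    from (no m≢pi) (yes m≡qi) = moved-swapNeighbours-pair p-swap r-swap pi≢i ri≢i (≢-sym ri≢pi) σp σr σm≡i
      m≢pi (λ m≡ri → ri≢qi (trans (sym m≡ri) m≡qi))
    from (no m≢pi) (no m≢qi) = moved-swapNeighbours-pair p-swap q-swap pi≢i qi≢i pi≢qi σp σq σm≡i m≢pi m≢qi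

|supp∩supp|≡0⇒Disjoint : ∀ {n} {a b : Sym n} → |supp∩supp| a b ≡ 0 → Disjoint (a ⟨$⟩ʳ_) (b ⟨$⟩ʳ_)
|supp∩supp|≡0⇒Disjoint {a = a} {b} count k ak≢k with b ⟨$⟩ʳ k ≟ k
... | yes bk≡k = bk≡k
... | no bk≢k = contradiction (sym count) (<⇒≢ (∈-length k∈filter))
  where
  k∈filter = ∈-filter⁺ (λ k → ¬? ((a ⟨$⟩ʳ k) ≟ k) ×-dec ¬? ((b ⟨$⟩ʳ k) ≟ k)) (∈-allFin k) (ak≢k , bk≢k)

InF⇒IsSwap : ∀ {n} {i : Fin (suc n)} {y : Sym n} → InF i y → IsSwap (y ⟨$⟩ʳ_)
InF⇒IsSwap {i = zero} y-swap = y-swap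
InF⇒IsSwap {i = suc _} (y-swap , _) = y-swap

module _ {n : ℕ} (x : Sym n) where

  ≈·⇒·⁻¹≈ : ∀ {v y} → v ≈ y · x → v · x ⁻¹ ≈ y
  ≈·⇒·⁻¹≈ v≈yx k = trans (cong (x ⟨$⟩ˡ_) (v≈yx k)) (inverseˡ x)

  ·⁻¹≗id⇒≈ : ∀ {w} → (w · x ⁻¹) ⟨$⟩ʳ_ ≗ id → w ≈ x
  ·⁻¹≗id⇒≈ σ≗id k = trans (sym (inverseʳ x)) (cong (x ⟨$⟩ʳ_) (σ≗id k))

  ≈·-injective : ∀ {v v′ y y′} → v ≈ y · x → v′ ≈ y′ · x → y ⟨$⟩ʳ_ ≗ y′ ⟨$⟩ʳ_ → v ≈ v′
  ≈·-injective v≈yx v′≈y′x y≗y′ k = trans (v≈yx k) (trans (cong (x ⟨$⟩ʳ_) (y≗y′ k)) (sym (v′≈y′x k)))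

  CTAdj⇒SwapAdjacent : ∀ {v y w} → v ≈ y · x → CTAdj v w → SwapAdjacent (y ⟨$⟩ʳ_) ((w · x ⁻¹) ⟨$⟩ʳ_)
  CTAdj⇒SwapAdjacent {v} {y} v≈yx (u , u-swap , w≈uv) =
    (u ⟨$⟩ʳ_) , u-swap , λ k → trans (cong (x ⟨$⟩ˡ_) (w≈uv k)) (≈·⇒·⁻¹≈ {v} {y} v≈yx (u ⟨$⟩ʳ k))

module MiddleVertices {n : ℕ} (G : SpanningSubgraph n) (i : Fin (suc n)) (x : Sym n) where
  open SpanningSubgraph G using (Edge; subgraph) renaming (sym to Edge-sym)

  middle : ∀ {P Q} → AuxAdj G i x P Q → Sym n
  middle (_ , w , _) = w

  middle-edgeˡ : ∀ {P Q} (e : AuxAdj G i x P Q) → Edge P (middle e)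
  middle-edgeˡ (_ , _ , _ , Pw , _) = Pw

  middle-edgeʳ : ∀ {P Q} (e : AuxAdj G i x P Q) → Edge (middle e) Q
  middle-edgeʳ (_ , _ , _ , _ , wQ) = wQ

  middle≉auxVertex : ∀ {P Q R} (e : AuxAdj G i x P Q) → AuxVertex i x P → AuxVertex i x R → ¬ middle e ≈ R
  middle≉auxVertex {P} (_ , w , _ , Pw , _) (p , p∈F , P≈px) (r , r∈F , R≈rx) w≈R
    with CTAdj⇒SwapAdjacent x {P} {p} {w} P≈px (subgraph Pw)
  ... | t , t-swap , σ≗pt =
    swap-not-swapAdjacent (InF⇒IsSwap {i = i} {y = p} p∈F) (InF⇒IsSwap {i = i} {y = r} r∈F)
      (t , t-swap , λ k → trans (sym (≈·⇒·⁻¹≈ x {w} {r} (λ k → trans (w≈R k) (R≈rx k)) k)) (σ≗pt k))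

  noThirdAuxNeighbour : ∀ {P Q R} (e : AuxAdj G i x P Q) →
    AuxVertex i x P → AuxVertex i x Q → AuxVertex i x R →
    Edge (middle e) R → ¬ P ≈ Q → ¬ R ≈ P → ¬ R ≈ Q → ⊥
  noThirdAuxNeighbour {P} {Q} {R} (count , w , w≉x , Pw , wQ)
    (p , p∈F , P≈px) (q , q∈F , Q≈qx) (r , r∈F , R≈rx) wR = by-index i p∈F q∈F r∈F count
    where
    σp : SwapAdjacent (p ⟨$⟩ʳ_) ((w · x ⁻¹) ⟨$⟩ʳ_)
    σp = CTAdj⇒SwapAdjacent x {P} {p} {w} P≈px (subgraph Pw)
    σq : SwapAdjacent (q ⟨$⟩ʳ_) ((w · x ⁻¹) ⟨$⟩ʳ_)
    σq = CTAdj⇒SwapAdjacent x {Q} {q} {w} Q≈qx (subgraph (Edge-sym wQ))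
    σr : SwapAdjacent (r ⟨$⟩ʳ_) ((w · x ⁻¹) ⟨$⟩ʳ_)
    σr = CTAdj⇒SwapAdjacent x {R} {r} {w} R≈rx (subgraph (Edge-sym wR))
    σ≢id : ¬ (w · x ⁻¹) ⟨$⟩ʳ_ ≗ id
    σ≢id = w≉x ∘ ·⁻¹≗id⇒≈ x {w}
    by-index : ∀ j → InF j p → InF j q → InF j r → |supp∩supp| (P · x ⁻¹) (Q · x ⁻¹) ≡ δ j →
      ¬ P ≈ Q → ¬ R ≈ P → ¬ R ≈ Q → ⊥
    by-index zero p-swap q-swap r-swap count _ R≉P R≉Q
      with swapNeighbours-of-disjoint p-swap q-swap r-swap p⊥q σ≢id σp σq σr
      where
      p⊥q : Disjoint (p ⟨$⟩ʳ_) (q ⟨$⟩ʳ_)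
      p⊥q k pk≢k = trans (sym (≈·⇒·⁻¹≈ x {Q} {q} Q≈qx k))
        (|supp∩supp|≡0⇒Disjoint {a = P · x ⁻¹} {Q · x ⁻¹} count k
          (λ e → pk≢k (trans (sym (≈·⇒·⁻¹≈ x {P} {p} P≈px k)) e)))
    ... | inj₁ r≗p = R≉P (≈·-injective x {R} {P} {r} {p} R≈rx P≈px r≗p)
    ... | inj₂ r≗q = R≉Q (≈·-injective x {R} {Q} {r} {q} R≈rx Q≈qx r≗q)
    by-index (suc j) (p-swap , pj≢j) (q-swap , qj≢j) (r-swap , rj≢j) _ P≉Q R≉P R≉Q =
      σ≢id (moved-swapNeighbours p-swap q-swap r-swap pj≢j qj≢j rj≢j
        (P≉Q ∘ ≈·-injective x {P} {Q} {p} {q} P≈px Q≈qx ∘ moved-swap-determined p-swap q-swap pj≢j)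
        (R≉P ∘ ≈·-injective x {R} {P} {r} {p} R≈rx P≈px ∘ moved-swap-determined r-swap p-swap rj≢j)
        (R≉Q ∘ ≈·-injective x {R} {Q} {r} {q} R≈rx Q≈qx ∘ moved-swap-determined r-swap q-swap rj≢j)
        σp σq σr)

module _ {m : ℕ} where

  toℕ-next : (k : Fin (suc m)) → toℕ (next k) ≡ suc (toℕ k) % suc m
  toℕ-next k = toℕ-fromℕ< _

  toℕ-mod : ∀ q → toℕ (q mod suc m) ≡ q % suc m
  toℕ-mod q = toℕ-fromℕ< _

  next-mod : ∀ q → next (q mod suc m) ≡ suc q mod suc m
  next-mod q = toℕ-injective (begin
    toℕ (next (q mod suc m))                ≡⟨ toℕ-next (q mod suc m) ⟩
    suc (toℕ (q mod suc m)) % suc m         ≡⟨ cong (λ r → suc r % suc m) (toℕ-mod q) ⟩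
    (1 + q % suc m) % suc m                 ≡⟨ %-distribˡ-+ 1 (q % suc m) (suc m) ⟩
    (1 % suc m + q % suc m % suc m) % suc m ≡⟨ cong (λ r → (1 % suc m + r) % suc m) (m%n%n≡m%n q (suc m)) ⟩
    (1 % suc m + q % suc m) % suc m         ≡⟨ %-distribˡ-+ 1 q (suc m) ⟨
    suc q % suc m                           ≡⟨ toℕ-mod (suc q) ⟨
    toℕ (suc q mod suc m)                   ∎)

  mod-injective : ∀ {q q′} → q < suc m → q′ < suc m → q mod suc m ≡ q′ mod suc m → q ≡ q′
  mod-injective {q} {q′} q<l q′<l q≡q′ = begin
    q                   ≡⟨ m<n⇒m%n≡m q<l ⟨
    q % suc m           ≡⟨ toℕ-mod q ⟨
    toℕ (q mod suc m)   ≡⟨ cong toℕ q≡q′ ⟩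
    toℕ (q′ mod suc m)  ≡⟨ toℕ-mod q′ ⟩
    q′ % suc m          ≡⟨ m<n⇒m%n≡m q′<l ⟩
    q′                  ∎

  next-cases : (k : Fin (suc m)) → toℕ (next k) ≡ suc (toℕ k) ⊎ (toℕ (next k) ≡ 0 × toℕ k ≡ m)
  next-cases k with m≤n⇒m<n∨m≡n (toℕ≤pred[n] k)
  ... | inj₁ k<m = inj₁ (trans (toℕ-next k) (m<n⇒m%n≡m (s≤s k<m)))
  ... | inj₂ k≡m =
    inj₂ (trans (toℕ-next k) (trans (cong (λ r → suc r % suc m) k≡m) (n%n≡0 (suc m))) , k≡m)

  next-periodic : ∀ {A : Set} (f : ℕ → A) → f (suc m) ≡ f 0 →
    (k : Fin (suc m)) → f (toℕ (next k)) ≡ f (suc (toℕ k))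
  next-periodic f f-period k with next-cases k
  ... | inj₁ next≡1+k = cong f next≡1+k
  ... | inj₂ (next≡0 , k≡m) = trans (cong f next≡0) (trans (sym f-period) (cong (f ∘ suc) (sym k≡m)))

next≢id : ∀ {m} (k : Fin (suc (suc m))) → next k ≢ k
next≢id k next≡k with next-cases k
... | inj₁ next≡1+k = 1+n≢n (trans (sym next≡1+k) (cong toℕ next≡k))
... | inj₂ (next≡0 , k≡last) = 0≢1+n (trans (sym next≡0) (trans (cong toℕ next≡k) k≡last))

next²≢id : ∀ {m} (k : Fin (suc (suc (suc m)))) → next (next k) ≢ k
next²≢id k next²≡k with next-cases k | next-cases (next k)
... | inj₁ a | inj₁ b = m≢1+n+m (toℕ k) (trans (sym (cong toℕ next²≡k)) (trans b (cong suc a)))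
... | inj₁ a | inj₂ (b , c) = 0≢1+n (trans (sym b) (trans (cong toℕ next²≡k) (suc-injective (trans (sym a) c))))
... | inj₂ (a , c) | inj₁ b = 0≢1+n (suc-injective (trans (sym (trans b (cong suc a))) (trans (cong toℕ next²≡k) c)))
... | inj₂ (a , _) | inj₂ (_ , d) = 0≢1+n (trans (sym a) d)

step : ℕ × Bool → ℕ × Bool
step (q , false) = q , true
step (q , true) = suc q , false

halve : ℕ → ℕ × Bool
halve zero = 0 , false
halve (suc k) = step (halve k)

double : ℕ × Bool → ℕ
double (q , false) = 2 * q
double (q , true) = suc (2 * q)

double-halve : ∀ k → double (halve k) ≡ k
double-halve zero = refl
double-halve (suc k) = trans (double-step (halve k)) (cong suc (double-halve k))
  where
  double-step : ∀ p → double (step p) ≡ suc (double p)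
  double-step (q , false) = refl
  double-step (q , true) = *-suc 2 q

halve-even : ∀ q → halve (2 * q) ≡ (q , false)
halve-even zero = refl
halve-even (suc q) = trans (cong halve (*-suc 2 q)) (cong (step ∘ step) (halve-even q))

halve-bound : ∀ {l} k → k < 2 * l → proj₁ (halve k) < l
halve-bound {l} k k<2l =
  *-cancelˡ-< 2 _ _ (≤-<-trans (2q≤double (halve k)) (subst (_< 2 * l) (sym (double-halve k)) k<2l))
  where
  2q≤double : ∀ p → 2 * proj₁ p ≤ double p
  2q≤double (q , false) = ≤-refl
  2q≤double (q , true) = n≤1+n _

module _ {n : ℕ} (G : SpanningSubgraph n) where
  open SpanningSubgraph G using (Edge)

  interleavedCycle : ∀ {m} (v w : Fin (suc m) → Sym n) →
    (∀ j → Edge (v j) (w j)) → (∀ j → Edge (w j) (v (next j))) →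
    (∀ j k → j ≢ k → ¬ v j ≈ v k) → (∀ j k → j ≢ k → ¬ w j ≈ w k) → (∀ j k → ¬ w j ≈ v k) →
    CycleIn G (2 * suc m)
  interleavedCycle {m} v w vw wv v-distinct w-distinct w≉v = u , (λ _ → tt) , u-distinct , u-adjacent
    where
    l : ℕ
    l = suc m

    at : ℕ × Bool → Sym n
    at (q , false) = v (q mod l)
    at (q , true) = w (q mod l)

    at-step : ∀ p → Edge (at p) (at (step p))
    at-step (q , false) = vw (q mod l)
    at-step (q , true) = subst (λ j → Edge (w (q mod l)) (v j)) (next-mod q) (wv (q mod l))

    at-distinct : ∀ p p′ → proj₁ p < l → proj₁ p′ < l → p ≢ p′ → ¬ at p ≈ at p′
    at-distinct (q , false) (q′ , false) q<l q′<l p≢p′ =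
      v-distinct _ _ (p≢p′ ∘ cong (_, false) ∘ mod-injective q<l q′<l)
    at-distinct (q , false) (q′ , true) _ _ _ v≈w = w≉v _ _ (λ k → sym (v≈w k))
    at-distinct (q , true) (q′ , false) _ _ _ = w≉v _ _
    at-distinct (q , true) (q′ , true) q<l q′<l p≢p′ =
      w-distinct _ _ (p≢p′ ∘ cong (_, true) ∘ mod-injective q<l q′<l)

    walk : ℕ → Sym n
    walk k = at (halve k)

    walk-period : walk (2 * l) ≡ walk 0
    walk-period = trans (cong at (halve-even l)) (cong v (toℕ-injective (trans (toℕ-mod l) (n%n≡0 l))))

    u : Fin (2 * l) → Sym n
    u k = walk (toℕ k)

    u-adjacent : ∀ k → Edge (u k) (u (next k))
    u-adjacent k = subst (Edge (u k)) (sym (next-periodic walk walk-period k)) (at-step (halve (toℕ k)))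

    u-distinct : ∀ j k → j ≢ k → ¬ u j ≈ u k
    u-distinct j k j≢k = at-distinct (halve (toℕ j)) (halve (toℕ k))
      (halve-bound (toℕ j) (toℕ<n j)) (halve-bound (toℕ k) (toℕ<n k))
      λ halves≡ → j≢k (toℕ-injective
        (trans (sym (double-halve (toℕ j))) (trans (cong double halves≡) (double-halve (toℕ k)))))

lemma2p6 : (n : ℕ) → n ≥ 3 → (G : SpanningSubgraph n) → (l : ℕ) → l ≥ 3 →
    (∃[ i ] ∃[ x ] CycleInAux G i x l) → CycleIn G (2 * l)
lemma2p6 n _ G (suc (suc (suc m))) (s≤s (s≤s (s≤s _))) (i , x , v , v-aux , v-distinct , v-adj) =
  interleavedCycle G v w (middle-edgeˡ ∘ v-adj) (middle-edgeʳ ∘ v-adj) v-distinct w-distinct w≉v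
  where
  open SpanningSubgraph G using (respects) renaming (sym to Edge-sym)
  open MiddleVertices G i x

  w : Fin (suc (suc (suc m))) → Sym n
  w j = middle (v-adj j)

  w≉v : ∀ j k → ¬ w j ≈ v k
  w≉v j k = middle≉auxVertex {R = v k} (v-adj j) (v-aux j) (v-aux k)

  w-distinct : ∀ j k → j ≢ k → ¬ w j ≈ w k
  w-distinct j k j≢k wj≈wk with k ≟ next j
  ... | yes refl = noThirdAuxNeighbour {R = v (next k)} (v-adj j) (v-aux j) (v-aux (next j)) (v-aux (next k))
        (respects (λ z → sym (wj≈wk z)) (λ _ → refl) (middle-edgeʳ (v-adj k)))
        (v-distinct j (next j) (≢-sym (next≢id j))) (v-distinct (next k) j (next²≢id j))
        (v-distinct (next k) k (next≢id k))
  ... | no k≢next = noThirdAuxNeighbour {R = v k} (v-adj j) (v-aux j) (v-aux (next j)) (v-aux k)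
        (respects (λ z → sym (wj≈wk z)) (λ _ → refl) (Edge-sym (middle-edgeˡ (v-adj k))))
        (v-distinct j (next j) (≢-sym (next≢id j))) (v-distinct k j (≢-sym j≢k)) (v-distinct k (next j) k≢next)
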